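{- Let $G$ be a finite simple graph with $|G|$ vertices and maximum degree $\Delta(G)$. If $\Delta(G)\geq \frac{2}{3}|G|-1$, then $a_{eq}(G)\leq \left\lceil\frac{\Delta(G)+1}{2}\right\rceil$.
   Context: All graphs are finite, undirected, without loops or multiple edges; $|G|$ denotes the number of vertices of $G$. A graph $G$ admits an equitable $k$-tree-coloring if $V(G)$ can be partitioned into $k$ subsets, each of size $\lceil |G|/k\rceil$ or $\lfloor |G|/k\rfloor$, such that each subset induces a forest in $G$. The equitable vertex arboricity $a_{eq}(G)$ is the minimum integer $k$ such that $G$ has an equitable $k$-tree-coloring. -}

module Defs where

open import Data.Nat using (ℕ; zero; suc; _+_; _*_; _∸_; _≤_; _⊔_; NonZero)
open import Data.Nat.DivMod using (_/_)
open import Data.Bool using (Bool; true; false; if_then_else_)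
open import Data.Fin using (Fin; zero; suc)
open import Data.List using (List; []; _∷_; _++_; [_]; length)
open import Data.List.Relation.Unary.All using (All)
open import Data.List.Relation.Unary.Unique.Propositional using (Unique)
open import Data.List.Relation.Unary.Linked using (Linked)
open import Data.Product using (Σ; _×_; ∃)
open import Data.Sum using (_⊎_)
open import Relation.Binary.PropositionalEquality using (_≡_; _≢_)
open import Relation.Nullary using (¬_; Dec; does)
open import Data.Fin using (_≟_)

record Graph (n : ℕ) : Set where
  field
    adj   : Fin n → Fin n → Bool
    sym   : ∀ u v → adj u v ≡ adj v u
    irrefl : ∀ v → adj v v ≡ false
open Graph public

count : ∀ {n} → (Fin n → Bool) → ℕ
count {zero}  p = 0
count {suc n} p = (if p zero then 1 else 0) + count (λ i → p (suc i))

degree : ∀ {n} → Graph n → Fin n → ℕ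
degree G v = count (adj G v)

-- maximum degree Δ(G)  (0 for the empty graph)
maxOver : ∀ {n} → (Fin n → ℕ) → ℕ
maxOver {zero}  f = 0
maxOver {suc n} f = f zero ⊔ maxOver (λ i → f (suc i))

Δ : ∀ {n} → Graph n → ℕ
Δ G = maxOver (degree G)

Adj : ∀ {n} → Graph n → Fin n → Fin n → Set
Adj G u v = adj G u v ≡ true

record CycleIn {n} (G : Graph n) (P : Fin n → Set) : Set where
  field
    v      : Fin n
    vs     : List (Fin n)
    long   : 3 ≤ length (v ∷ vs)
    distinct : Unique (v ∷ vs)
    inP    : All P (v ∷ vs)
    closed : Linked (Adj G) (v ∷ vs ++ [ v ])

InducesForest : ∀ {n} → Graph n → (Fin n → Set) → Set
InducesForest G P = ¬ CycleIn G P

⌈_/_⌉ : (m k : ℕ) → .{{NonZero k}} → ℕ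
⌈ m / k ⌉ = (m + k ∸ 1) / k

classSize : ∀ {n k} → (Fin n → Fin k) → Fin k → ℕ
classSize c i = count (λ v → does (c v ≟ i))

record EquitableTreeColoring {n} (G : Graph n) (k : ℕ) .{{_ : NonZero k}} : Set where
  field
    colour   : Fin n → Fin k
    balanced : ∀ i → classSize colour i ≡ ⌈ n / k ⌉ ⊎ classSize colour i ≡ n / k
    forest   : ∀ i → InducesForest G (λ v → colour v ≡ i)

-- a_eq(G) ≤ m : some k with 1 ≤ k ≤ m admits an equitable k-tree-coloring
-- (a_eq is the least such k).
aeq≤ : ∀ {n} → Graph n → ℕ → Set
aeq≤ G m = Σ ℕ λ k → k ≤ m × Σ (NonZero k) λ nz → EquitableTreeColoring G k {{nz}}

module Submission where

-- With k = ⌈(Δ+1)/2⌉ every degree is below 2k and |G| ≤ 3k. Place the vertices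
-- at positions 0, …, |G| − 1 and colour position p by p mod k: the classes are
-- balanced, and class i occupies the positions i, k + i, 2k + i that exist. A class
-- of at most three vertices is a forest unless it is a triangle, which needs
-- position 2k + i, i.e. i < t = |G| − 2k. So it suffices that the vertices u₁, u₂ at
-- positions j and k + j are non-adjacent for every j < t, which is arranged column
-- by column. Each vertex has at least t non-neighbours. If u₁ or u₂ has one outside
-- the columns already fixed, swap it next to the other. Otherwise the more than m
-- non-neighbours of each lie in the 2m fixed positions, so some fixed column holds
-- a non-neighbour x of u₁ next to a non-neighbour y of u₂, and swapping x with u₂
-- separates both columns.

open import Data.Bool using (Bool; true; false; if_then_else_; not; _∧_; _∨_)
open import Data.Bool.Properties using (∧-identityʳ; ¬-not) renaming (_≟_ to _≟ᵇ_)
open import Data.Empty using (⊥-elim)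
open import Data.Fin using (Fin; zero; suc; toℕ; fromℕ<)
open import Data.Fin.Permutation using (Permutation′; _⟨$⟩ʳ_; _⟨$⟩ˡ_; _∘ₚ_; transpose; inverseˡ)
  renaming (id to idₚ)
open import Data.Fin.Properties using (_≟_; any?; toℕ<n; toℕ-fromℕ<; fromℕ<-toℕ; toℕ-injective)
open import Data.List using (List; []; _∷_; length)
open import Data.List.Membership.Propositional using (_∈_)
open import Data.List.Relation.Unary.All as All using (All; []; _∷_)
open import Data.List.Relation.Unary.All.Properties using (¬Any⇒All¬)
open import Data.List.Relation.Unary.AllPairs using ([]; _∷_)
import Data.List.Relation.Unary.Any as List
open import Data.List.Relation.Unary.Any using (here; there)
open import Data.List.Relation.Unary.Linked using ([-]; _∷_)
open import Data.List.Relation.Unary.Unique.Propositional using (Unique)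
open import Data.Nat
  using (ℕ; zero; suc; _+_; _*_; _∸_; _≤_; _<_; z≤n; s≤s; s≤s⁻¹; NonZero; >-nonZero; ⌈_/2⌉)
open import Data.Nat.DivMod
open import Data.Nat.Divisibility using (n∣m*n)
open import Data.Nat.Properties hiding (_≟_)
import Data.Nat.Properties as ℕ
open import Data.Nat.Solver using (module +-*-Solver)
open import Data.Product using (Σ; ∃; _×_; _,_; proj₁; proj₂)
open import Data.Sum using (_⊎_; inj₁; inj₂)
open import Function using (_∘_; case_of_)
open import Relation.Binary.PropositionalEquality
open import Relation.Nullary using (¬_; Dec; yes; no; does)
open import Relation.Nullary.Decidable using (dec-true; dec-false; _×-dec_; _⊎-dec_; ¬?)
open import Relation.Unary using (Pred; Decidable)

open import Defs hiding (sym)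

open import Algebra.Properties.CommutativeMonoid.Sum +-0-commutativeMonoid using (sum; sum-permute)

private
  variable
    n : ℕ

-- Counting

count-cong : {p q : Fin n → Bool} → (∀ i → p i ≡ q i) → count p ≡ count q
count-cong {zero}  eq = refl
count-cong {suc n} eq = cong₂ (λ b c → (if b then 1 else 0) + c) (eq zero) (count-cong (eq ∘ suc))

count≡sum : (p : Fin n → Bool) → count p ≡ sum (λ i → if p i then 1 else 0)
count≡sum {zero}  p = refl
count≡sum {suc n} p = cong ((if p zero then 1 else 0) +_) (count≡sum (p ∘ suc))

count-permute : (π : Permutation′ n) (p : Fin n → Bool) → count p ≡ count (p ∘ (π ⟨$⟩ʳ_))
count-permute π p =
  trans (count≡sum p) (trans (sum-permute _ π) (sym (count≡sum (p ∘ (π ⟨$⟩ʳ_)))))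

count-false : count (λ (_ : Fin n) → false) ≡ 0
count-false {zero}  = refl
count-false {suc n} = count-false {n}

count-≟ : (u : Fin n) → count (λ v → does (v ≟ u)) ≡ 1
count-≟ {suc n} zero    = cong suc (count-false {n})
count-≟ {suc n} (suc u) = count-≟ u

count-complement : (p : Fin n → Bool) → count p + count (not ∘ p) ≡ n
count-complement {zero}  p = refl
count-complement {suc n} p with p zero
... | true  = cong suc (count-complement (p ∘ suc))
... | false = trans (+-suc _ _) (cong suc (count-complement (p ∘ suc)))

count-∨ : (p q : Fin n → Bool) → count (λ i → p i ∨ q i) ≤ count p + count q
count-∨ {zero}  p q = z≤n
count-∨ {suc n} p q with p zero | q zero | count-∨ (p ∘ suc) (q ∘ suc)
... | true  | true  | le = s≤s (≤-trans le (≤-trans (n≤1+n _) (≤-reflexive (sym (+-suc _ _)))))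
... | true  | false | le = s≤s le
... | false | true  | le = ≤-trans (s≤s le) (≤-reflexive (sym (+-suc _ _)))
... | false | false | le = le

count-remove : (p : Fin n → Bool) {x : Fin n} → p x ≡ true →
               count p ≡ suc (count (λ v → p v ∧ not (does (v ≟ x))))
count-remove {suc n} p {zero} px rewrite px =
  cong suc (count-cong (λ v → sym (∧-identityʳ (p (suc v)))))
count-remove {suc n} p {suc x} px rewrite ∧-identityʳ (p zero) with p zero
... | true  = cong suc (count-remove (p ∘ suc) px)
... | false = count-remove (p ∘ suc) px

unique-length≤count : ∀ {ℓ} {P : Pred (Fin n) ℓ} (P? : Decidable P) {xs : List (Fin n)} →
                      Unique xs → All P xs → length xs ≤ count (does ∘ P?)
unique-length≤count P? []              []         = z≤n
unique-length≤count {P = P} P? {x ∷ xs} (x≢xs ∷ xs!) (Px ∷ Pxs) = begin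
  suc (length xs)                                      ≤⟨ s≤s (unique-length≤count P?-x xs! P-x) ⟩
  suc (count (λ v → does (P? v) ∧ not (does (v ≟ x)))) ≡⟨ count-remove (does ∘ P?) (dec-true (P? x) Px) ⟨
  count (does ∘ P?)                                    ∎
  where
    open ≤-Reasoning
    P?-x : Decidable (λ v → P v × ¬ v ≡ x)
    P?-x v = P? v ×-dec ¬? (v ≟ x)
    P-x : All (λ v → P v × ¬ v ≡ x) xs
    P-x = All.zipWith (λ (Pv , x≢v) → Pv , x≢v ∘ sym) (Pxs , x≢xs)

count≤length⇒∈ : ∀ {ℓ} {P : Pred (Fin n) ℓ} (P? : Decidable P) {xs : List (Fin n)} →
                 Unique xs → All P xs → count (does ∘ P?) ≤ length xs → ∀ {w} → P w → w ∈ xs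
count≤length⇒∈ P? {xs} xs! Pxs full {w} Pw with List.any? (w ≟_) xs
... | yes w∈xs = w∈xs
... | no  w∉xs = ⊥-elim (<-irrefl refl (≤-trans
      (unique-length≤count P? (¬Any⇒All¬ xs w∉xs ∷ xs!) (Pw ∷ Pxs)) full))

countBelow : ℕ → (ℕ → Bool) → ℕ
countBelow n P = count {n} (P ∘ toℕ)

module _ {P : ℕ → Bool} where

  countBelow-cong : {Q : ℕ → Bool} → (∀ q → q < n → P q ≡ Q q) → countBelow n P ≡ countBelow n Q
  countBelow-cong eq = count-cong (λ i → eq (toℕ i) (toℕ<n i))

  countBelow-none : (∀ q → q < n → P q ≡ false) → countBelow n P ≡ 0
  countBelow-none {n} none = trans (countBelow-cong none) (count-false {n})

countBelow-+ : ∀ m n (P : ℕ → Bool) → countBelow (m + n) P ≡ countBelow m P + countBelow n (P ∘ (m +_))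
countBelow-+ zero    n P = refl
countBelow-+ (suc m) n P =
  trans (cong ((if P 0 then 1 else 0) +_) (countBelow-+ m n (P ∘ suc))) (sym (+-assoc (if P 0 then 1 else 0) _ _))

module _ {m n : ℕ} {P : ℕ → Bool} (m≤n : m ≤ n) where

  private
    split : countBelow n P ≡ countBelow m P + countBelow (n ∸ m) (P ∘ (m +_))
    split = trans (cong (λ l → countBelow l P) (sym (m+[n∸m]≡n m≤n))) (countBelow-+ m (n ∸ m) P)

  countBelow-mono : countBelow m P ≤ countBelow n P
  countBelow-mono = ≤-trans (m≤m+n _ _) (≤-reflexive (sym split))

  countBelow-truncate : (∀ q → m ≤ q → q < n → P q ≡ false) → countBelow n P ≡ countBelow m P
  countBelow-truncate none = trans split (trans (cong (countBelow m P +_) (countBelow-none tail)) (+-identityʳ _))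
    where
      tail : ∀ q → q < n ∸ m → P (m + q) ≡ false
      tail q q< = none (m + q) (m≤m+n m q) (subst (m + q <_) (m+[n∸m]≡n m≤n) (+-monoʳ-< m q<))

Overlap : ℕ → (ℕ → Bool) → (ℕ → Bool) → Set
Overlap m P Q = Σ ℕ λ j → j < m × P j ≡ true × Q j ≡ true

Overlap-suc : ∀ {m P Q} → Overlap m (P ∘ suc) (Q ∘ suc) → Overlap (suc m) P Q
Overlap-suc (j , j<m , Pj , Qj) = suc j , s≤s j<m , Pj , Qj

countBelow-overlap : ∀ m {P Q : ℕ → Bool} → m < countBelow m P + countBelow m Q → Overlap m P Q
countBelow-overlap (suc m) {P} {Q} big with P 0 in P0 | Q 0 in Q0
... | true  | true  = 0 , s≤s z≤n , P0 , Q0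
... | true  | false = Overlap-suc (countBelow-overlap m (s≤s⁻¹ big))
... | false | true  = Overlap-suc (countBelow-overlap m (s≤s⁻¹ (subst (suc m <_) (+-suc _ _) big)))
... | false | false = Overlap-suc (countBelow-overlap m (<-trans (n<1+n m) big))

majority-split : ∀ {m} a b c d → m < a + b → m < c + d → m < a + d ⊎ m < c + b
majority-split {m} a b c d m<a+b m<c+d with m <? a + d | m <? c + b
... | yes m<a+d | _         = inj₁ m<a+d
... | no  _     | yes m<c+b = inj₂ m<c+b
... | no  m≮a+d | no  m≮c+b = ⊥-elim (<-irrefl refl (begin-strict
  m + m             <⟨ +-mono-< m<a+b m<c+d ⟩
  a + b + (c + d)   ≡⟨ solve 4 (λ a b c d → a :+ b :+ (c :+ d) := a :+ d :+ (c :+ b)) refl a b c d ⟩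
  a + d + (c + b)   ≤⟨ +-mono-≤ (≮⇒≥ m≮a+d) (≮⇒≥ m≮c+b) ⟩
  m + m             ∎))
  where open ≤-Reasoning
        open +-*-Solver

extend : (Fin n → Bool) → ℕ → Bool
extend {n} g q with q <? n
... | yes q<n = g (fromℕ< q<n)
... | no  _   = false

module _ (g : Fin n → Bool) where

  extend-toℕ : ∀ p → extend g (toℕ p) ≡ g p
  extend-toℕ p with toℕ p <? n
  ... | yes p<n = cong g (fromℕ<-toℕ p p<n)
  ... | no  p≮n = ⊥-elim (p≮n (toℕ<n p))

  count≡countBelow-extend : count g ≡ countBelow n (extend g)
  count≡countBelow-extend = count-cong (sym ∘ extend-toℕ)

  extend-true : ∀ {q} → extend g q ≡ true → Σ (Fin n) λ p → toℕ p ≡ q × g p ≡ true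
  extend-true {q} gq with q <? n
  ... | yes q<n = fromℕ< q<n , toℕ-fromℕ< q<n , gq

does-≟-toℕ : (x y : Fin n) → does (x ≟ y) ≡ does (toℕ x ℕ.≟ toℕ y)
does-≟-toℕ zero    zero    = refl
does-≟-toℕ zero    (suc y) = refl
does-≟-toℕ (suc x) zero    = refl
does-≟-toℕ (suc x) (suc y) = does-≟-toℕ x y

countBelow-≟-< : ∀ {i r} → i < r → countBelow r (λ q → does (q ℕ.≟ i)) ≡ 1
countBelow-≟-< {i} i<r = trans (count-cong same) (count-≟ (fromℕ< i<r))
  where
    same : ∀ v → does (toℕ v ℕ.≟ i) ≡ does (v ≟ fromℕ< i<r)
    same v = trans (cong (λ j → does (toℕ v ℕ.≟ j)) (sym (toℕ-fromℕ< i<r))) (sym (does-≟-toℕ v _))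

countBelow-≟-≥ : ∀ {i r} → r ≤ i → countBelow r (λ q → does (q ℕ.≟ i)) ≡ 0
countBelow-≟-≥ r≤i = countBelow-none (λ q q<r → dec-false (q ℕ.≟ _) (<⇒≢ (<-≤-trans q<r r≤i)))

-- Residue classes

⌈m/n⌉≡1+m/n : ∀ m n .{{_ : NonZero n}} → 0 < m % n → ⌈ m / n ⌉ ≡ suc (m / n)
⌈m/n⌉≡1+m/n m n 0<m%n with m % n | m≡m%n+[m/n]*n m n | m%n<n m n
... | suc r | m≡ | r<n = begin
  (m + n ∸ 1) / n             ≡⟨ /-congˡ shifted ⟩
  (r + suc (m / n) * n) / n   ≡⟨ +-distrib-/-∣ʳ r (n∣m*n (suc (m / n))) ⟩
  r / n + suc (m / n) * n / n ≡⟨ cong₂ _+_ (m<n⇒m/n≡0 (<-trans (n<1+n r) r<n)) (m*n/n≡m (suc (m / n)) n) ⟩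
  suc (m / n)                 ∎
  where
    open ≡-Reasoning
    shifted : m + n ∸ 1 ≡ r + suc (m / n) * n
    shifted = begin
      m + n ∸ 1                   ≡⟨ cong (λ l → l + n ∸ 1) m≡ ⟩
      r + m / n * n + n           ≡⟨ +-assoc r (m / n * n) n ⟩
      r + (m / n * n + n)         ≡⟨ cong (r +_) (+-comm (m / n * n) n) ⟩
      r + suc (m / n) * n         ∎

n≤⌈n/2⌉+⌈n/2⌉ : ∀ m → m ≤ ⌈ m /2⌉ + ⌈ m /2⌉
n≤⌈n/2⌉+⌈n/2⌉ m =
  subst (_≤ ⌈ m /2⌉ + ⌈ m /2⌉) (⌊n/2⌋+⌈n/2⌉≡n m) (+-monoˡ-≤ ⌈ m /2⌉ (⌊n/2⌋≤⌈n/2⌉ m))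

module Residues (k : ℕ) .{{_ : NonZero k}} {i : ℕ} (i<k : i < k) where

  atResidue : ℕ → Bool
  atResidue q = does (q % k ℕ.≟ i)

  atI : ℕ → Bool
  atI q = does (q ℕ.≟ i)

  residues : ℕ → ℕ
  residues n = countBelow n atResidue

  residues-≤k : ∀ {r} → r ≤ k → residues r ≡ countBelow r atI
  residues-≤k {r} r≤k = countBelow-cong {n = r} (λ q q<r → cong atI (m<n⇒m%n≡m (<-≤-trans q<r r≤k)))

  residues-k : residues k ≡ 1
  residues-k = trans (residues-≤k ≤-refl) (countBelow-≟-< i<k)

  residues-i : residues i ≡ 0
  residues-i = trans (residues-≤k (<⇒≤ i<k)) (countBelow-≟-≥ {i = i} ≤-refl)

  residues-+k : ∀ n → residues (k + n) ≡ suc (residues n)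
  residues-+k n = begin
    residues (k + n)                               ≡⟨ countBelow-+ k n atResidue ⟩
    residues k + countBelow n (atResidue ∘ (k +_)) ≡⟨ cong₂ _+_ residues-k periodic ⟩
    suc (residues n)                               ∎
    where
      open ≡-Reasoning
      periodic : countBelow n (atResidue ∘ (k +_)) ≡ residues n
      periodic = countBelow-cong {n = n} (λ q _ → cong atI (trans (cong (_% k) (+-comm k q)) ([m+n]%n≡m%n q k)))

  residues-*+ : ∀ a r → residues (a * k + r) ≡ a + residues r
  residues-*+ zero    r = refl
  residues-*+ (suc a) r = trans (cong residues (+-assoc k (a * k) r))
                                (trans (residues-+k (a * k + r)) (cong suc (residues-*+ a r)))

  residues-by-division : ∀ n → residues n ≡ n / k + countBelow (n % k) atI
  residues-by-division n = begin
    residues n                     ≡⟨ cong residues (trans (m≡m%n+[m/n]*n n k) (+-comm (n % k) _)) ⟩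
    residues (n / k * k + n % k)   ≡⟨ residues-*+ (n / k) (n % k) ⟩
    n / k + residues (n % k)       ≡⟨ cong (n / k +_) (residues-≤k (<⇒≤ (m%n<n n k))) ⟩
    n / k + countBelow (n % k) atI ∎
    where open ≡-Reasoning

  residues-balanced : ∀ n → residues n ≡ ⌈ n / k ⌉ ⊎ residues n ≡ n / k
  residues-balanced n with i <? n % k
  ... | yes i<r = inj₁ (begin
    residues n                     ≡⟨ residues-by-division n ⟩
    n / k + countBelow (n % k) atI ≡⟨ cong (n / k +_) (countBelow-≟-< i<r) ⟩
    n / k + 1                      ≡⟨ +-comm (n / k) 1 ⟩
    suc (n / k)                    ≡⟨ ⌈m/n⌉≡1+m/n n k (≤-<-trans z≤n i<r) ⟨
    ⌈ n / k ⌉                      ∎)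
    where open ≡-Reasoning
  ... | no  i≮r = inj₂ (begin
    residues n                     ≡⟨ residues-by-division n ⟩
    n / k + countBelow (n % k) atI ≡⟨ cong (n / k +_) (countBelow-≟-≥ (≮⇒≥ i≮r)) ⟩
    n / k + 0                      ≡⟨ +-identityʳ (n / k) ⟩
    n / k                          ∎)
    where open ≡-Reasoning

  residues-+2k : ∀ r → residues (k + (k + r)) ≡ 2 + residues r
  residues-+2k r = trans (residues-+k (k + r)) (cong suc (residues-+k r))

  residues≤3 : ∀ {n} → n ≤ k + (k + k) → residues n ≤ 3
  residues≤3 n≤3k = ≤-trans (countBelow-mono {P = atResidue} n≤3k)
                            (≤-reflexive (trans (residues-+2k k) (cong (2 +_) residues-k)))

  3≤residues⇒k+[k+i]<n : ∀ {n} → 3 ≤ residues n → k + (k + i) < n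
  3≤residues⇒k+[k+i]<n {n} three≤ with k + (k + i) <? n
  ... | yes lt = lt
  ... | no  ≮  = ⊥-elim (<-irrefl refl (≤-trans three≤ (≤-trans (countBelow-mono {P = atResidue} (≮⇒≥ ≮))
                   (≤-reflexive (trans (residues-+2k i) (cong (2 +_) residues-i))))))

module _ (a b : Fin n) where

  transpose-left : transpose a b ⟨$⟩ʳ a ≡ b
  transpose-left rewrite dec-true (a ≟ a) refl = refl

  transpose-right : transpose a b ⟨$⟩ʳ b ≡ a
  transpose-right with b ≟ a
  ... | yes b≡a = b≡a
  ... | no  _   rewrite dec-true (b ≟ b) refl = refl

  transpose-other : ∀ {p} → p ≢ a → p ≢ b → transpose a b ⟨$⟩ʳ p ≡ p
  transpose-other {p} p≢a p≢b rewrite dec-false (p ≟ a) p≢a | dec-false (p ≟ b) p≢b = refl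

⟨$⟩ʳ-injective : (π : Permutation′ n) {p q : Fin n} → π ⟨$⟩ʳ p ≡ π ⟨$⟩ʳ q → p ≡ q
⟨$⟩ʳ-injective π eq = trans (sym (inverseˡ π)) (trans (cong (π ⟨$⟩ˡ_) eq) (inverseˡ π))

maxOver-upper : (f : Fin n → ℕ) (i : Fin n) → f i ≤ maxOver f
maxOver-upper f zero    = m≤m⊔n _ _
maxOver-upper f (suc i) = ≤-trans (maxOver-upper (f ∘ suc) i) (m≤n⊔m _ _)

module _ (G : Graph n) (u : Fin n) where

  nonNeighbour : Fin n → Bool
  nonNeighbour v = not (does (v ≟ u) ∨ adj G u v)

  nonNeighbour-≢ : ∀ {v} → nonNeighbour v ≡ true → v ≢ u
  nonNeighbour-≢ {v} nv v≡u rewrite dec-true (v ≟ u) v≡u = case nv of λ ()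

  nonNeighbour-nonadjacent : ∀ {v} → nonNeighbour v ≡ true → adj G u v ≡ false
  nonNeighbour-nonadjacent {v} nv with does (v ≟ u) | adj G u v
  ... | false | false = refl

  count-nonNeighbour : n ≤ suc (degree G u) + count nonNeighbour
  count-nonNeighbour = begin
    n                                            ≡⟨ count-complement closed ⟨
    count closed + count nonNeighbour            ≤⟨ +-monoˡ-≤ _ (count-∨ is-u (adj G u)) ⟩
    count is-u + degree G u + count nonNeighbour ≡⟨ cong (λ c → c + degree G u + count nonNeighbour) (count-≟ u) ⟩
    suc (degree G u) + count nonNeighbour        ∎
    where
      open ≤-Reasoning
      is-u closed : Fin n → Bool
      is-u v = does (v ≟ u)
      closed v = is-u v ∨ adj G u v

module _ (G : Graph n) where

  Adj-sym : ∀ {u v} → Adj G u v → Adj G v u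
  Adj-sym {u} {v} uv = trans (Graph.sym G v u) uv

  triangle-adjacent : ∀ {a b c x y} → Adj G a b → Adj G b c → Adj G c a →
                      x ∈ a ∷ b ∷ c ∷ [] → y ∈ a ∷ b ∷ c ∷ [] → x ≢ y → Adj G x y
  triangle-adjacent ab bc ca (here refl)                 (here refl)                 x≢y = ⊥-elim (x≢y refl)
  triangle-adjacent ab bc ca (here refl)                 (there (here refl))         _   = ab
  triangle-adjacent ab bc ca (here refl)                 (there (there (here refl))) _   = Adj-sym ca
  triangle-adjacent ab bc ca (there (here refl))         (here refl)                 _   = Adj-sym ab
  triangle-adjacent ab bc ca (there (here refl))         (there (here refl))         x≢y = ⊥-elim (x≢y refl)
  triangle-adjacent ab bc ca (there (here refl))         (there (there (here refl))) _   = bc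
  triangle-adjacent ab bc ca (there (there (here refl))) (here refl)                 _   = ca
  triangle-adjacent ab bc ca (there (there (here refl))) (there (here refl))         _   = Adj-sym bc
  triangle-adjacent ab bc ca (there (there (here refl))) (there (there (here refl))) x≢y = ⊥-elim (x≢y refl)

-- Separating arrangements

module Arrangement {n} (G : Graph n) (k : ℕ)
  (degree<2k : ∀ u → suc (degree G u) ≤ k + k) (n≤3k : n ≤ k + (k + k)) where

  t : ℕ
  t = n ∸ (k + k)

  t≤k : t ≤ k
  t≤k = m≤n+o⇒m∸n≤o n (k + k) (≤-trans n≤3k (≤-reflexive (sym (+-assoc k k k))))

  t≤count-nonNeighbour : ∀ u → t ≤ count (nonNeighbour G u)
  t≤count-nonNeighbour u =
    m≤n+o⇒m∸n≤o n (k + k) (≤-trans (count-nonNeighbour G u) (+-monoˡ-≤ _ (degree<2k u)))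

  private
    rearrange : ∀ j → suc (k + (k + j)) ≡ suc j + (k + k)
    rearrange j = cong suc (trans (sym (+-assoc k k j)) (+-comm (k + k) j))

  j<t⇒k+[k+j]<n : ∀ {j} → j < t → k + (k + j) < n
  j<t⇒k+[k+j]<n {j} j<t = subst (_≤ n) (sym (rearrange j)) (m≤o∸n⇒m+n≤o (suc j) 2k≤n j<t)
    where
      2k≤n : k + k ≤ n
      2k≤n = <⇒≤ (m∸n≢0⇒n<m (>⇒≢ (≤-<-trans z≤n j<t)))

  k+[k+j]<n⇒j<t : ∀ {j} → k + (k + j) < n → j < t
  k+[k+j]<n⇒j<t {j} lt = m+n≤o⇒m≤o∸n (suc j) (subst (_≤ n) (rearrange j) lt)

  -- π ⟨$⟩ʳ p is the vertex placed at position p; column j consists of the positions j and k + j.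
  Separated : Permutation′ n → ℕ → Set
  Separated π j = ∀ p q → toℕ p ≡ j → toℕ q ≡ k + j → adj G (π ⟨$⟩ʳ p) (π ⟨$⟩ʳ q) ≡ false

  SeparatedBelow : Permutation′ n → ℕ → Set
  SeparatedBelow π m = ∀ j → j < m → Separated π j

  separated-at : ∀ {π j} p q → toℕ p ≡ j → toℕ q ≡ k + j →
                 adj G (π ⟨$⟩ʳ p) (π ⟨$⟩ʳ q) ≡ false → Separated π j
  separated-at p q p≡j q≡k+j pq p′ q′ p′≡j q′≡k+j
    rewrite toℕ-injective (trans p′≡j (sym p≡j)) | toℕ-injective (trans q′≡k+j (sym q≡k+j)) = pq

  SeparatedBelow-suc : ∀ {π m} → SeparatedBelow π m → Separated π m → SeparatedBelow π (suc m)
  SeparatedBelow-suc below at j j<1+m with m≤n⇒m<n∨m≡n (s≤s⁻¹ j<1+m)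
  ... | inj₁ j<m  = below j j<m
  ... | inj₂ refl = at

  InColumn : ℕ → Fin n → Set
  InColumn j p = toℕ p ≡ j ⊎ toℕ p ≡ k + j

  columns-disjoint : ∀ {i j p} → i < k → j < k → InColumn i p → InColumn j p → i ≡ j
  columns-disjoint i<k j<k (inj₁ p≡i)   (inj₁ p≡j)   = trans (sym p≡i) p≡j
  columns-disjoint i<k j<k (inj₁ p≡i)   (inj₂ p≡k+j) =
    ⊥-elim (<⇒≱ i<k (subst (k ≤_) (trans (sym p≡k+j) p≡i) (m≤m+n k _)))
  columns-disjoint i<k j<k (inj₂ p≡k+i) (inj₁ p≡j)   =
    ⊥-elim (<⇒≱ j<k (subst (k ≤_) (trans (sym p≡k+i) p≡j) (m≤m+n k _)))
  columns-disjoint i<k j<k (inj₂ p≡k+i) (inj₂ p≡k+j) = +-cancelˡ-≡ k _ _ (trans (sym p≡k+i) p≡k+j)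

  separated-transpose : ∀ {π j} a b → Separated π j → (∀ x → InColumn j x → x ≢ a × x ≢ b) →
                        Separated (transpose a b ∘ₚ π) j
  separated-transpose {π} a b sep avoid p q p≡j q≡k+j
    with avoid p (inj₁ p≡j) | avoid q (inj₂ q≡k+j)
  ... | p≢a , p≢b | q≢a , q≢b =
    subst₂ (λ x y → adj G (π ⟨$⟩ʳ x) (π ⟨$⟩ʳ y) ≡ false)
      (sym (transpose-other a b p≢a p≢b)) (sym (transpose-other a b q≢a q≢b)) (sep p q p≡j q≡k+j)

  -- Position q lies in one of the columns j < m.
  Settled : ℕ → ℕ → Set
  Settled m q = q < m ⊎ (k ≤ q × q < k + m)

  settled? : ∀ m q → Dec (Settled m q)
  settled? m q = (q <? m) ⊎-dec ((k ≤? q) ×-dec (q <? k + m))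

  column-settled : ∀ {j m x} → j < m → InColumn j x → Settled m (toℕ x)
  column-settled j<m (inj₁ x≡j)   = inj₁ (subst (_< _) (sym x≡j) j<m)
  column-settled j<m (inj₂ x≡k+j) =
    inj₂ (subst (k ≤_) (sym x≡k+j) (m≤m+n k _) , subst (_< _) (sym x≡k+j) (+-monoʳ-< k j<m))

  m-unsettled : ∀ {m} → m < k → ¬ Settled m m
  m-unsettled m<k (inj₁ m<m)      = <-irrefl refl m<m
  m-unsettled m<k (inj₂ (k≤m , _)) = <⇒≱ m<k k≤m

  k+m-unsettled : ∀ {m} → ¬ Settled m (k + m)
  k+m-unsettled {m} (inj₁ k+m<m)       = <⇒≱ k+m<m (m≤n+m m k)
  k+m-unsettled     (inj₂ (_ , k+m<k+m)) = <-irrefl refl k+m<k+m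

  Partners : ℕ → Fin n → Fin n → Set
  Partners j x y = (toℕ x ≡ j × toℕ y ≡ k + j) ⊎ (toℕ x ≡ k + j × toℕ y ≡ j)

  Supported : ℕ → (Fin n → Bool) → Set
  Supported m S = ∀ p → S p ≡ true → Settled m (toℕ p)

  Crossing : ℕ → (Fin n → Bool) → (Fin n → Bool) → Set
  Crossing m S₁ S₂ =
    Σ ℕ λ j → j < m × Σ (Fin n) λ x → Σ (Fin n) λ y → Partners j x y × S₁ x ≡ true × S₂ y ≡ true

  module _ {m} (m≤k : m ≤ k) (k+m≤n : k + m ≤ n) where

    extend-unsettled : ∀ {S} → Supported m S → ∀ q → ¬ Settled m q → extend S q ≡ false
    extend-unsettled {S} supp q unsettled = ¬-not λ Sq → case extend-true S Sq of λ
      (p , p≡q , Sp) → unsettled (subst (Settled m) p≡q (supp p Sp))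

    count-settled : ∀ S → Supported m S → count S ≡ countBelow m (extend S) + countBelow m (extend S ∘ (k +_))
    count-settled S supp = begin
      count S                                          ≡⟨ count≡countBelow-extend S ⟩
      countBelow n E                                   ≡⟨ cong (λ l → countBelow l E) (m+[n∸m]≡n k≤n) ⟨
      countBelow (k + (n ∸ k)) E                       ≡⟨ countBelow-+ k (n ∸ k) E ⟩
      countBelow k E + countBelow (n ∸ k) (E ∘ (k +_)) ≡⟨ cong₂ _+_ (countBelow-truncate m≤k left-gap)
                                                                   (countBelow-truncate m≤n∸k right-gap) ⟩
      countBelow m E + countBelow m (E ∘ (k +_))       ∎
      where
        open ≡-Reasoning
        E : ℕ → Bool
        E = extend S
        k≤n : k ≤ n
        k≤n = ≤-trans (m≤m+n k m) k+m≤n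
        m≤n∸k : m ≤ n ∸ k
        m≤n∸k = m+n≤o⇒m≤o∸n m (subst (_≤ n) (+-comm k m) k+m≤n)
        left-gap : ∀ q → m ≤ q → q < k → E q ≡ false
        left-gap q m≤q q<k = extend-unsettled supp q λ
          { (inj₁ q<m)       → <⇒≱ q<m m≤q
          ; (inj₂ (k≤q , _)) → <⇒≱ q<k k≤q }
        right-gap : ∀ q → m ≤ q → q < n ∸ k → E (k + q) ≡ false
        right-gap q m≤q _ = extend-unsettled supp (k + q) λ
          { (inj₁ k+q<m)           → <⇒≱ k+q<m (≤-trans m≤k (m≤m+n k q))
          ; (inj₂ (_ , k+q<k+m)) → <⇒≱ (+-cancelˡ-< k q m k+q<k+m) m≤q }

    crossing : ∀ S₁ S₂ → Supported m S₁ → Supported m S₂ →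
               m < count S₁ → m < count S₂ → Crossing m S₁ S₂
    crossing S₁ S₂ supp₁ supp₂ big₁ big₂
      with majority-split (countBelow m (extend S₁)) (countBelow m (extend S₁ ∘ (k +_)))
                          (countBelow m (extend S₂)) (countBelow m (extend S₂ ∘ (k +_)))
                          (subst (m <_) (count-settled S₁ supp₁) big₁)
                          (subst (m <_) (count-settled S₂ supp₂) big₂)
    ... | inj₁ big with countBelow-overlap m big
    ...   | j , j<m , E₁j , E₂k+j with extend-true S₁ E₁j | extend-true S₂ E₂k+j
    ...     | x , x≡j , S₁x | y , y≡k+j , S₂y = j , j<m , x , y , inj₁ (x≡j , y≡k+j) , S₁x , S₂y
    crossing S₁ S₂ supp₁ supp₂ big₁ big₂ | inj₂ big with countBelow-overlap m big
    ...   | j , j<m , E₂j , E₁k+j with extend-true S₁ E₁k+j | extend-true S₂ E₂j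
    ...     | x , x≡k+j , S₁x | y , y≡j , S₂y = j , j<m , x , y , inj₂ (x≡k+j , y≡j) , S₁x , S₂y

  Partners-inColumn : ∀ {j x y} → Partners j x y → InColumn j x × InColumn j y
  Partners-inColumn (inj₁ (x≡j , y≡k+j)) = inj₁ x≡j , inj₂ y≡k+j
  Partners-inColumn (inj₂ (x≡k+j , y≡j)) = inj₂ x≡k+j , inj₁ y≡j

  Partners-≢ : ∀ {j x y} → 0 < k → Partners j x y → y ≢ x
  Partners-≢ 0<k (inj₁ (x≡j , y≡k+j)) refl = <⇒≢ (m<n+m _ 0<k) (trans (sym x≡j) y≡k+j)
  Partners-≢ 0<k (inj₂ (x≡k+j , y≡j)) refl = <⇒≢ (m<n+m _ 0<k) (trans (sym y≡j) x≡k+j)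

  unsettled-avoids : ∀ {a j m x} → ¬ Settled m (toℕ a) → j < m → InColumn j x → x ≢ a
  unsettled-avoids a-unsettled j<m col refl = a-unsettled (column-settled j<m col)

  module Step (π : Permutation′ n) {m} (m<t : m < t) (below : SeparatedBelow π m) where

    m<k : m < k
    m<k = <-≤-trans m<t t≤k

    k+m<n : k + m < n
    k+m<n = ≤-<-trans (+-monoʳ-≤ k (m≤n+m m k)) (j<t⇒k+[k+j]<n m<t)

    Pm Qm : Fin n
    Pm = fromℕ< (≤-<-trans (m≤n+m m k) k+m<n)
    Qm = fromℕ< k+m<n

    Pm-column : toℕ Pm ≡ m
    Pm-column = toℕ-fromℕ< _

    Qm-column : toℕ Qm ≡ k + m
    Qm-column = toℕ-fromℕ< _

    Pm-unsettled : ¬ Settled m (toℕ Pm)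
    Pm-unsettled = subst (¬_ ∘ Settled m) (sym Pm-column) (m-unsettled m<k)

    Qm-unsettled : ¬ Settled m (toℕ Qm)
    Qm-unsettled = subst (¬_ ∘ Settled m) (sym Qm-column) k+m-unsettled

    Pm≢Qm : Pm ≢ Qm
    Pm≢Qm Pm≡Qm =
      <⇒≢ (m<n+m m (≤-<-trans z≤n m<k)) (trans (sym Pm-column) (trans (cong toℕ Pm≡Qm) Qm-column))

    u₁ u₂ : Fin n
    u₁ = π ⟨$⟩ʳ Pm
    u₂ = π ⟨$⟩ʳ Qm

    swap-Qm-separates : ∀ {p} → nonNeighbour G u₁ (π ⟨$⟩ʳ p) ≡ true → Separated (transpose Qm p ∘ₚ π) m
    swap-Qm-separates {p} nn = separated-at {transpose Qm p ∘ₚ π} Pm Qm Pm-column Qm-column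
      (subst₂ (λ x y → adj G (π ⟨$⟩ʳ x) (π ⟨$⟩ʳ y) ≡ false)
        (sym (transpose-other Qm p Pm≢Qm Pm≢p)) (sym (transpose-left Qm p)) (nonNeighbour-nonadjacent G u₁ nn))
      where
        Pm≢p : Pm ≢ p
        Pm≢p refl = nonNeighbour-≢ G u₁ nn refl

    swap-Pm-separates : ∀ {p} → nonNeighbour G u₂ (π ⟨$⟩ʳ p) ≡ true → Separated (transpose Pm p ∘ₚ π) m
    swap-Pm-separates {p} nn = separated-at {transpose Pm p ∘ₚ π} Pm Qm Pm-column Qm-column
      (subst₂ (λ x y → adj G (π ⟨$⟩ʳ x) (π ⟨$⟩ʳ y) ≡ false)
        (sym (transpose-left Pm p)) (sym (transpose-other Pm p (Pm≢Qm ∘ sym) Qm≢p))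
        (trans (Graph.sym G _ u₂) (nonNeighbour-nonadjacent G u₂ nn)))
      where
        Qm≢p : Qm ≢ p
        Qm≢p refl = nonNeighbour-≢ G u₂ nn refl

    swap-unsettled : ∀ {a b} → ¬ Settled m (toℕ a) → ¬ Settled m (toℕ b) →
                     SeparatedBelow (transpose a b ∘ₚ π) m
    swap-unsettled {a} {b} a-uns b-uns j j<m = separated-transpose {π} a b (below j j<m)
      (λ x col → unsettled-avoids a-uns j<m col , unsettled-avoids b-uns j<m col)

    swap-crossing : ∀ {j x y} → j < m → Partners j x y →
               nonNeighbour G u₁ (π ⟨$⟩ʳ x) ≡ true → nonNeighbour G u₂ (π ⟨$⟩ʳ y) ≡ true →
               SeparatedBelow (transpose Qm x ∘ₚ π) (suc m)
    swap-crossing {j} {x} {y} j<m partners u₁x u₂y = SeparatedBelow-suc {π′} columns-below (swap-Qm-separates u₁x)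
      where
        π′ : Permutation′ n
        π′ = transpose Qm x ∘ₚ π
        x-column : InColumn j x
        x-column = proj₁ (Partners-inColumn partners)
        y-column : InColumn j y
        y-column = proj₂ (Partners-inColumn partners)
        x↦u₂ : π′ ⟨$⟩ʳ x ≡ u₂
        x↦u₂ = cong (π ⟨$⟩ʳ_) (transpose-right Qm x)
        y↦y : π′ ⟨$⟩ʳ y ≡ π ⟨$⟩ʳ y
        y↦y = cong (π ⟨$⟩ʳ_) (transpose-other Qm x (unsettled-avoids Qm-unsettled j<m y-column)
                                                     (Partners-≢ (≤-<-trans z≤n m<k) partners))
        u₂-y : adj G u₂ (π ⟨$⟩ʳ y) ≡ false
        u₂-y = nonNeighbour-nonadjacent G u₂ u₂y
        column-j : Partners j x y → Separated π′ j
        column-j (inj₁ (x≡j , y≡k+j)) = separated-at {π′} x y x≡j y≡k+j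
                (subst₂ (λ a b → adj G a b ≡ false) (sym x↦u₂) (sym y↦y) u₂-y)
        column-j (inj₂ (x≡k+j , y≡j)) = separated-at {π′} y x y≡j x≡k+j
                (subst₂ (λ a b → adj G a b ≡ false) (sym y↦y) (sym x↦u₂) (trans (Graph.sym G _ u₂) u₂-y))
        columns-below : SeparatedBelow π′ m
        columns-below i i<m with i ℕ.≟ j
        ... | yes refl = column-j partners
        ... | no  i≢j  = separated-transpose {π} Qm x (below i i<m) λ z z-column →
          unsettled-avoids Qm-unsettled i<m z-column ,
          λ { refl → i≢j (columns-disjoint (<-trans i<m m<k) (<-trans j<m m<k) z-column x-column) }

    UnsettledNonNeighbour : Fin n → Set
    UnsettledNonNeighbour u = ∃ λ p → nonNeighbour G u (π ⟨$⟩ʳ p) ≡ true × ¬ Settled m (toℕ p)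

    unsettledNonNeighbour? : ∀ u → Dec (UnsettledNonNeighbour u)
    unsettledNonNeighbour? u =
      any? λ p → (nonNeighbour G u (π ⟨$⟩ʳ p) ≟ᵇ true) ×-dec ¬? (settled? m (toℕ p))

    settled-nonNeighbours : ∀ {u} → ¬ UnsettledNonNeighbour u → Supported m (nonNeighbour G u ∘ (π ⟨$⟩ʳ_))
    settled-nonNeighbours none p np with settled? m (toℕ p)
    ... | yes settled  = settled
    ... | no  unsettled = ⊥-elim (none (p , np , unsettled))

    many-nonNeighbours : ∀ u → m < count (nonNeighbour G u ∘ (π ⟨$⟩ʳ_))
    many-nonNeighbours u = <-≤-trans m<t (≤-trans (t≤count-nonNeighbour u) (≤-reflexive (count-permute π _)))

    -- If u₁ and u₂ are not adjacent, the first case applies with p = Qm.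
    next-column : Σ (Permutation′ n) λ π′ → SeparatedBelow π′ (suc m)
    next-column with unsettledNonNeighbour? u₁
    ... | yes (p , u₁p , p-unsettled) =
      transpose Qm p ∘ₚ π ,
      SeparatedBelow-suc {transpose Qm p ∘ₚ π} (swap-unsettled Qm-unsettled p-unsettled) (swap-Qm-separates u₁p)
    ... | no none₁ with unsettledNonNeighbour? u₂
    ...   | yes (p , u₂p , p-unsettled) =
      transpose Pm p ∘ₚ π ,
      SeparatedBelow-suc {transpose Pm p ∘ₚ π} (swap-unsettled Pm-unsettled p-unsettled) (swap-Pm-separates u₂p)
    ...   | no none₂ with crossing (<⇒≤ m<k) (<⇒≤ k+m<n) _ _
                                  (settled-nonNeighbours none₁) (settled-nonNeighbours none₂)
                                  (many-nonNeighbours u₁) (many-nonNeighbours u₂)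
    ...     | j , j<m , x , y , partners , u₁x , u₂y = transpose Qm x ∘ₚ π , swap-crossing j<m partners u₁x u₂y

  separating-arrangement : ∀ m → m ≤ t → Σ (Permutation′ n) λ π → SeparatedBelow π m
  separating-arrangement zero    _     = idₚ , λ _ ()
  separating-arrangement (suc m) m<t with separating-arrangement m (<⇒≤ m<t)
  ... | π , below = Step.next-column π m<t below

-- Colouring by position

module ColourByPosition (k : ℕ) .{{_ : NonZero k}} (π : Permutation′ n) where

  colour : Fin n → Fin k
  colour v = toℕ (π ⟨$⟩ˡ v) mod k

  colour-at : ∀ p {i} → toℕ p % k ≡ toℕ i → colour (π ⟨$⟩ʳ p) ≡ i
  colour-at p p%k≡i =
    toℕ-injective (trans (cong (λ q → toℕ (toℕ q mod k)) (inverseˡ π)) (trans (toℕ-fromℕ< _) p%k≡i))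

  classSize≡residues : ∀ i → classSize colour i ≡ Residues.residues k (toℕ<n i) n
  classSize≡residues i = trans (count-permute π _) (count-cong same)
    where
      same : ∀ p → does (colour (π ⟨$⟩ʳ p) ≟ i) ≡ does (toℕ p % k ℕ.≟ toℕ i)
      same p = trans (cong (λ q → does (toℕ q mod k ≟ i)) (inverseˡ π))
             (trans (does-≟-toℕ (toℕ p mod k) i)
                    (cong (λ l → does (l ℕ.≟ toℕ i)) (toℕ-fromℕ< (m%n<n (toℕ p) k))))

  colour-balanced : ∀ i → classSize colour i ≡ ⌈ n / k ⌉ ⊎ classSize colour i ≡ n / k
  colour-balanced i rewrite classSize≡residues i = Residues.residues-balanced k (toℕ<n i) n

module Construction {n} (G : Graph n) (k : ℕ) .{{_ : NonZero k}}
  (degree<2k : ∀ u → suc (degree G u) ≤ k + k) (n≤3k : n ≤ k + (k + k)) where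

  open Arrangement G k degree<2k n≤3k

  π : Permutation′ n
  π = proj₁ (separating-arrangement t ≤-refl)

  open ColourByPosition k π

  class? : ∀ i → Decidable (λ v → colour v ≡ i)
  class? i v = colour v ≟ i

  classSize≤3 : ∀ i → classSize colour i ≤ 3
  classSize≤3 i rewrite classSize≡residues i = Residues.residues≤3 k (toℕ<n i) n≤3k

  SeparatedPair : Fin k → Set
  SeparatedPair i = Σ (Fin n) λ w₀ → Σ (Fin n) λ w₁ →
    colour w₀ ≡ i × colour w₁ ≡ i × w₀ ≢ w₁ × adj G w₀ w₁ ≡ false

  full-class-separated : ∀ i → 3 ≤ classSize colour i → SeparatedPair i
  full-class-separated i full = π ⟨$⟩ʳ P , π ⟨$⟩ʳ Q , P-in , Q-in , P≢Q ∘ ⟨$⟩ʳ-injective π ,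
                                proj₂ (separating-arrangement t ≤-refl) (toℕ i) (k+[k+j]<n⇒j<t third) P Q P-at Q-at
    where
      i<k : toℕ i < k
      i<k = toℕ<n i
      third : k + (k + toℕ i) < n
      third = Residues.3≤residues⇒k+[k+i]<n k i<k (subst (3 ≤_) (classSize≡residues i) full)
      k+i<n : k + toℕ i < n
      k+i<n = ≤-<-trans (m≤n+m _ k) third
      P Q : Fin n
      P = fromℕ< (≤-<-trans (m≤n+m _ k) k+i<n)
      Q = fromℕ< k+i<n
      P-at : toℕ P ≡ toℕ i
      P-at = toℕ-fromℕ< _
      Q-at : toℕ Q ≡ k + toℕ i
      Q-at = toℕ-fromℕ< _
      P-in : colour (π ⟨$⟩ʳ P) ≡ i
      P-in = colour-at P (trans (cong (_% k) P-at) (m<n⇒m%n≡m i<k))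
      Q-in : colour (π ⟨$⟩ʳ Q) ≡ i
      Q-in = colour-at Q (trans (cong (_% k) (trans Q-at (+-comm k _))) (trans ([m+n]%n≡m%n _ k) (m<n⇒m%n≡m i<k)))
      P≢Q : P ≢ Q
      P≢Q P≡Q = <⇒≢ (m<n+m _ (≤-<-trans z≤n i<k)) (trans (sym P-at) (trans (cong toℕ P≡Q) Q-at))

  colour-forest : ∀ i → InducesForest G (λ v → colour v ≡ i)
  colour-forest i record { vs = [] ; long = s≤s () }
  colour-forest i record { vs = _ ∷ [] ; long = s≤s (s≤s ()) }
  colour-forest i record { vs = _ ∷ _ ∷ _ ∷ _ ; distinct = distinct ; inP = inP } =
    1+n≰n (≤-trans (s≤s (s≤s (s≤s (s≤s z≤n))))
                   (≤-trans (unique-length≤count (class? i) distinct inP) (classSize≤3 i)))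
  colour-forest i record { v = a ; vs = b ∷ c ∷ [] ; distinct = distinct ; inP = inP ; closed = ab ∷ bc ∷ ca ∷ [-] }
    with full-class-separated i (unique-length≤count (class? i) distinct inP)
  ... | w₀ , w₁ , w₀-in , w₁-in , w₀≢w₁ , separated =
    case trans (sym (triangle-adjacent G ab bc ca (member w₀-in) (member w₁-in) w₀≢w₁)) separated of λ ()
    where
      member : ∀ {w} → colour w ≡ i → w ∈ a ∷ b ∷ c ∷ []
      member = count≤length⇒∈ (class? i) distinct inP (classSize≤3 i)

  equitableTreeColoring : EquitableTreeColoring G k
  equitableTreeColoring = record { colour = colour ; balanced = colour-balanced ; forest = colour-forest }

theorem2p4 : ∀ (n : ℕ) (G : Graph n) → 2 * n ≤ 3 * (Δ G + 1) → aeq≤ G ⌈ (Δ G + 1) /2⌉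
theorem2p4 n G 2n≤3[Δ+1] = k , ≤-refl , nonZero , Construction.equitableTreeColoring G k {{nonZero}} degree<2k n≤3k
  where
    k : ℕ
    k = ⌈ (Δ G + 1) /2⌉
    nonZero : NonZero k
    nonZero = >-nonZero (subst (λ m → 0 < ⌈ m /2⌉) (+-comm 1 (Δ G)) (s≤s z≤n))
    Δ+1≤2k : Δ G + 1 ≤ k + k
    Δ+1≤2k = n≤⌈n/2⌉+⌈n/2⌉ (Δ G + 1)
    degree<2k : ∀ u → suc (degree G u) ≤ k + k
    degree<2k u = ≤-trans (subst (_≤ Δ G + 1) (+-comm (degree G u) 1) (+-monoˡ-≤ 1 (maxOver-upper (degree G) u)))
                          Δ+1≤2k
    n≤3k : n ≤ k + (k + k)
    n≤3k = *-cancelˡ-≤ 2 (≤-trans 2n≤3[Δ+1]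
                         (≤-trans (*-monoʳ-≤ 3 Δ+1≤2k) (≤-reflexive 3[k+k]≡2[k+[k+k]])))
      where
        open +-*-Solver
        3[k+k]≡2[k+[k+k]] : 3 * (k + k) ≡ 2 * (k + (k + k))
        3[k+k]≡2[k+[k+k]] = solve 1 (λ k → con 3 :* (k :+ k) := con 2 :* (k :+ (k :+ k))) refl k
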